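{- Let $k\ge 3$ and $3<n\le k$. Then $G_{2,k}^n=G_{2,k}^{n,+}\cup G_{2,k}^{n,- }$.
   Context: $K=\{0,1,\ldots,k-1\}$; $P_k^n$ is the set of all functions $K^n\to K$ in variables $x_1,\ldots,x_n$. A variable $x_i$ is essential in $g$ if changing only the $i$-th argument can change the value of $g$; $Ess(g)$ is the set of essential variables, $ess(g)=|Ess(g)|$. For $i\neq j$, $g_{i\leftarrow j}(a_1,\ldots,a_n)=g(a_1,\ldots,a_{i-1},a_j,a_{i+1},\ldots,a_n)$. $Min(g)$ is the set of all $g_{i\leftarrow j}$ with $i\neq j$ and $x_i,x_j\in Ess(g)$; $gap(g)=ess(g)-\max_{t\in Min(g)}ess(t)$. $G_{p,k}^m=\{f\in P_k^n: ess(f)=m,\ gap(f)=p\}$. $G_{p,k}^{n,+}$ is the set of $f\in G_{p,k}^n$ for which there exist $i\neq j$ in $\{1,\ldots,n\}$ with $x_j\in Ess(f_{i\leftarrow j})$ and $ess(f_{i\leftarrow j})=n-p$. $G_{p,k}^{n,- }$ is the set of $f\in G_{p,k}^n$ such that $x_v\notin Ess(f_{u\leftarrow v})$ for all $u\neq v$ in $\{1,\ldots,n\}$. -}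

module Defs where

open import Data.Nat using (ℕ; zero; suc; _∸_; _⊔_)
open import Data.Fin using (Fin; zero; suc)
open import Data.Fin.Properties using (any?) renaming (_≟_ to _≟ᶠ_)
open import Data.Vec using (Vec; []; _∷_; lookup; _[_]≔_)
open import Data.List using (List; length; filter; allFin; foldr; map; cartesianProduct)
open import Data.Product using (Σ; ∃; ∃-syntax; _×_; _,_; proj₁; proj₂)
open import Relation.Nullary using (Dec; yes; no; ¬_)
open import Relation.Nullary.Decidable using (map′; ¬?; _×-dec_)
open import Relation.Binary.PropositionalEquality using (_≡_; _≢_)

-- K = Fin k ; a function of P_k^n takes an n-tuple (Vec (Fin k) n) of arguments.
-- Variable x_{i+1} of the paper corresponds to index i : Fin n.
Fun : ℕ → ℕ → Set
Fun n k = Vec (Fin k) n → Fin k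

Essential : ∀ {n k} → Fun n k → Fin n → Set
Essential g i = ∃[ a ] ∃[ c ] (g a ≢ g (a [ i ]≔ c))

anyVec? : ∀ {k} n {P : Vec (Fin k) n → Set} → (∀ v → Dec (P v)) → Dec (∃ P)
anyVec? zero P? with P? []
... | yes p = yes ([] , p)
... | no ¬p = no λ { ([] , p) → ¬p p }
anyVec? (suc n) {P} P? =
  map′ (λ { (x , v , p) → (x ∷ v) , p })
       (λ { ((x ∷ v) , p) → x , v , p })
       (any? (λ x → anyVec? n (λ v → P? (x ∷ v))))

essential? : ∀ {n k} (g : Fun n k) (i : Fin n) → Dec (Essential g i)
essential? {n} g i =
  anyVec? n (λ a → any? (λ c → ¬? (g a ≟ᶠ g (a [ i ]≔ c))))

ess : ∀ {n k} → Fun n k → ℕ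
ess {n} g = length (filter (essential? g) (allFin n))

_⟨_←_⟩ : ∀ {n k} → Fun n k → Fin n → Fin n → Fun n k
(g ⟨ i ← j ⟩) a = g (a [ i ]≔ lookup a j)

-- the pairs (i , j) with i ≠ j and x_i , x_j essential in g (indexing Min(g))
MinPair : ∀ {n k} → Fun n k → Fin n × Fin n → Set
MinPair g (i , j) = (i ≢ j) × Essential g i × Essential g j

minPair? : ∀ {n k} (g : Fun n k) p → Dec (MinPair g p)
minPair? g (i , j) = ¬? (i ≟ᶠ j) ×-dec (essential? g i ×-dec essential? g j)

-- max_{t ∈ Min(g)} ess(t)   (0 if Min(g) is empty; never relevant below)
maxMin : ∀ {n k} → Fun n k → ℕ
maxMin {n} g =
  foldr _⊔_ 0
    (map (λ p → ess (g ⟨ proj₁ p ← proj₂ p ⟩))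
         (filter (minPair? g) (cartesianProduct (allFin n) (allFin n))))

gap : ∀ {n k} → Fun n k → ℕ
gap g = ess g ∸ maxMin g

InG : ∀ {n k} → ℕ → ℕ → Fun n k → Set
InG p m f = (ess f ≡ m) × (gap f ≡ p)

InG+ : ∀ {n k} → ℕ → Fun n k → Set
InG+ {n} p f = InG p n f ×
  (∃[ i ] ∃[ j ] ((i ≢ j) × Essential (f ⟨ i ← j ⟩) j × (ess (f ⟨ i ← j ⟩) ≡ n ∸ p)))

InG- : ∀ {n k} → ℕ → Fun n k → Set
InG- {n} p f = InG p n f ×
  (∀ (u v : Fin n) → u ≢ v → ¬ Essential (f ⟨ u ← v ⟩) v)

module Submission where

open import Defs
open import Data.Nat using (ℕ; suc; _≤_; _<_; _∸_; _+_; z≤n; s≤s)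
open import Data.Nat.Properties
  using (≤-reflexive; <⇒≤; m≤n⇒m≤1+n; <-≤-trans; m≤n⇒m≤n⊔o; m≤n⇒m≤o⊔n; ⊔-sel; 1+n≰n;
         <-irrefl; _≤?_; ≰⇒≥; m≤n⇒m∸n≡0; m∸[m∸n]≡n; m+[n∸m]≡n; m<n⇒0<n∸m; <⇒≢; ≤-antisym;
         m≤n+o⇒m∸n≤o; module ≤-Reasoning)
open import Data.Fin using (Fin)
open import Data.Fin.Properties using (_≟_; any?)
open import Data.Vec using (Vec; lookup; _[_]≔_)
open import Data.Vec.Properties
  using (lookup∘update; lookup∘update′; []≔-commutes; []≔-idempotent; []≔-lookup)
open import Data.List using (List; []; _∷_; length; filter; allFin; map; cartesianProduct)
open import Data.List.Properties using (length-filter; length-tabulate; filter-all; foldr-preservesᵒ)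
open import Data.List.Membership.Propositional using (_∈_)
open import Data.List.Membership.Propositional.Properties
  using (∈-allFin; ∈-map⁺; ∈-map⁻; ∈-filter⁺; ∈-filter⁻; ∈-cartesianProduct⁺; foldr-selective)
open import Data.List.Relation.Unary.Any as Any using (here; there)
open import Data.List.Relation.Unary.All as All using (universal)
open import Data.List.Relation.Unary.AllPairs using ([]; _∷_)
open import Data.List.Relation.Unary.Unique.Propositional using (Unique)
open import Data.List.Relation.Unary.Unique.Propositional.Properties using (allFin⁺)
open import Data.Sum using (_⊎_; inj₁; inj₂; [_,_]′)
open import Data.Product using (∃-syntax; _×_; _,_; proj₁; proj₂)
open import Function using (id; _∘_)
open import Relation.Nullary using (yes; no; ¬_; contradiction)
open import Relation.Nullary.Decidable using (¬?; _×-dec_; decidable-stable)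
open import Relation.Unary using (Decidable; _∪_; ｛_｝)
open import Relation.Unary.Properties using (_∪?_)
open import Relation.Binary.Definitions using (DecidableEquality)
open import Relation.Binary.PropositionalEquality
  using (_≡_; _≢_; refl; sym; trans; cong; subst; module ≡-Reasoning)

-- Every variable of f is essential and gap(f) = 2, so every identification f⟨i←j⟩ has at
-- most n − 2 essential variables, and some (i , j) attains n − 2.  If f is not in G⁻, some
-- x_v survives in f⟨u←v⟩.  Either x_j survives in the maximal f⟨i←j⟩ (and f ∈ G⁺), or
-- exactly x_i and x_j are lost: then f restricted to the diagonal x_i = x_j ignores the
-- common value of x_i, x_j but depends on every other variable.  For r ∉ {a , b}, x_r is
-- essential in f⟨a←b⟩ iff f restricted to the diagonal x_a = x_b depends on x_r, and moving
-- x_i, x_j jointly along their diagonal carries such dependences to other diagonals.  A case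
-- analysis on u, v against i, j thus yields an identification that keeps its target variable
-- and loses at most two variables, which is a witness for G⁺.

count : {A : Set} {P : A → Set} → Decidable P → List A → ℕ
count P? xs = length (filter P? xs)

module _ {A : Set} {P Q : A → Set} (P? : Decidable P) (Q? : Decidable Q) where

  count-mono : ∀ xs → (∀ {x} → x ∈ xs → P x → Q x) → count P? xs ≤ count Q? xs
  count-mono []       _   = z≤n
  count-mono (x ∷ xs) P⊆Q with P? x | Q? x | count-mono xs (P⊆Q ∘ there)
  ... | yes _  | yes _  | ih = s≤s ih
  ... | yes Px | no ¬Qx | _  = contradiction (P⊆Q (here refl) Px) ¬Qx
  ... | no _   | yes _  | ih = m≤n⇒m≤1+n ih
  ... | no _   | no _   | ih = ih

module _ {A : Set} (_≟ᴬ_ : DecidableEquality A) {P : A → Set} (P? : Decidable P) where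

  count-insert-< : ∀ {y xs} → y ∈ xs → ¬ P y → count P? xs < count (P? ∪? (y ≟ᴬ_)) xs
  count-insert-< {y} {_ ∷ xs} (here refl) ¬Py with P? y | y ≟ᴬ y
  ... | yes Py | _      = contradiction Py ¬Py
  ... | no _   | yes _  = s≤s (count-mono P? (P? ∪? (y ≟ᴬ_)) xs (λ _ → inj₁))
  ... | no _   | no y≢y = contradiction refl y≢y
  count-insert-< {y} {x ∷ _} (there y∈xs) ¬Py with P? x | y ≟ᴬ x | count-insert-< y∈xs ¬Py
  ... | yes _ | _     | ih = s≤s ih
  ... | no _  | yes _ | ih = m≤n⇒m≤1+n ih
  ... | no _  | no _  | ih = ih

  count-insert-≤ : ∀ {a xs} → Unique xs → count (P? ∪? (a ≟ᴬ_)) xs ≤ suc (count P? xs)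
  count-insert-≤ {xs = []} [] = z≤n
  count-insert-≤ {a} {x ∷ xs} (x∉xs ∷ xs!) with P? x | a ≟ᴬ x | count-insert-≤ xs!
  ... | yes _ | _      | ih = s≤s ih
  ... | no _  | no _   | ih = ih
  ... | no _  | yes refl | _ = s≤s (count-mono (P? ∪? (x ≟ᴬ_)) P? xs only-P)
    where
    only-P : ∀ {y} → y ∈ xs → (P ∪ ｛ x ｝) y → P y
    only-P _    (inj₁ Py)  = Py
    only-P y∈xs (inj₂ x≡y) = contradiction x≡y (All.lookup x∉xs y∈xs)

module _ {n : ℕ} where

  count-allFin-≤ : {P : Fin n → Set} (P? : Decidable P) → count P? (allFin n) ≤ n
  count-allFin-≤ P? = subst (count P? (allFin n) ≤_) (length-tabulate id) (length-filter P? (allFin n))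

  count-allFin≡n⇒universal : {P : Fin n → Set} (P? : Decidable P) →
                             count P? (allFin n) ≡ n → ∀ x → P x
  count-allFin≡n⇒universal P? count≡n x with P? x
  ... | yes Px = Px
  ... | no ¬Px = contradiction (subst (_< n) count≡n
      (<-≤-trans (count-insert-< _≟_ P? (∈-allFin x) ¬Px) (count-allFin-≤ (P? ∪? (x ≟_)))))
      (<-irrefl refl)

  three-missing⇒3+count≤n : {P : Fin n → Set} (P? : Decidable P) → ∀ {i j r} →
                            i ≢ j → i ≢ r → j ≢ r → ¬ P i → ¬ P j → ¬ P r →
                            3 + count P? (allFin n) ≤ n
  three-missing⇒3+count≤n {P} P? {i} {j} {r} i≢j i≢r j≢r ¬Pi ¬Pj ¬Pr = begin
    3 + count P? (allFin n)   ≤⟨ s≤s (s≤s (count-insert-< _≟_ P? (∈-allFin r) ¬Pr)) ⟩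
    2 + count Pr? (allFin n)  ≤⟨ s≤s (count-insert-< _≟_ Pr? (∈-allFin j) [ ¬Pj , j≢r ∘ sym ]′) ⟩
    1 + count Prj? (allFin n)
      ≤⟨ count-insert-< _≟_ Prj? (∈-allFin i) [ [ ¬Pi , i≢r ∘ sym ]′ , i≢j ∘ sym ]′ ⟩
    count (Prj? ∪? (i ≟_)) (allFin n) ≤⟨ count-allFin-≤ (Prj? ∪? (i ≟_)) ⟩
    n                         ∎
    where
    open ≤-Reasoning
    Pr? : Decidable (P ∪ ｛ r ｝)
    Pr? = P? ∪? (r ≟_)
    Prj? : Decidable ((P ∪ ｛ r ｝) ∪ ｛ j ｝)
    Prj? = Pr? ∪? (j ≟_)

  all-but-two⇒n≤2+count : {P : Fin n → Set} (P? : Decidable P) → ∀ {a b} →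
                          (∀ x → x ≢ a → x ≢ b → P x) → n ≤ 2 + count P? (allFin n)
  all-but-two⇒n≤2+count {P} P? {a} {b} P-outside = begin
    n                                   ≡⟨ sym (length-tabulate id) ⟩
    length (allFin n)                   ≡⟨ cong length (sym (filter-all Pab? (universal Pab (allFin n)))) ⟩
    count Pab? (allFin n)               ≤⟨ count-insert-≤ _≟_ Pa? (allFin⁺ n) ⟩
    1 + count Pa? (allFin n)            ≤⟨ s≤s (count-insert-≤ _≟_ P? (allFin⁺ n)) ⟩
    2 + count P? (allFin n)             ∎
    where
    open ≤-Reasoning
    Pa? : Decidable (P ∪ ｛ a ｝)
    Pa? = P? ∪? (a ≟_)
    Pab? : Decidable ((P ∪ ｛ a ｝) ∪ ｛ b ｝)
    Pab? = Pa? ∪? (b ≟_)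
    Pab : ∀ x → ((P ∪ ｛ a ｝) ∪ ｛ b ｝) x
    Pab x with a ≟ x | b ≟ x
    ... | yes a≡x | _       = inj₁ (inj₂ a≡x)
    ... | no _    | yes b≡x = inj₂ b≡x
    ... | no a≢x  | no b≢x  = inj₁ (inj₁ (P-outside x (a≢x ∘ sym) (b≢x ∘ sym)))

m∸n≡1+o⇒n≡m∸1+o : ∀ {m n o} → m ∸ n ≡ suc o → n ≡ m ∸ suc o
m∸n≡1+o⇒n≡m∸1+o {m} {n} eq with n ≤? m
... | yes n≤m = trans (sym (m∸[m∸n]≡n n≤m)) (cong (m ∸_) eq)
... | no n≰m  = contradiction (trans (sym (m≤n⇒m∸n≡0 (≰⇒≥ n≰m))) eq) (λ ())

module _ {n k : ℕ} (f : Fun n k) where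

  private
    pairs : List (Fin n × Fin n)
    pairs = cartesianProduct (allFin n) (allFin n)

    identifiedEss : Fin n × Fin n → ℕ
    identifiedEss p = ess (f ⟨ proj₁ p ← proj₂ p ⟩)

  maxMin-upper : ∀ {i j} → MinPair f (i , j) → ess (f ⟨ i ← j ⟩) ≤ maxMin f
  maxMin-upper {i} {j} ij∈Min =
    foldr-preservesᵒ (λ x y → [ m≤n⇒m≤n⊔o y , m≤n⇒m≤o⊔n x ]′) 0 _
      (inj₂ (Any.map ≤-reflexive
        (∈-map⁺ identifiedEss
          (∈-filter⁺ (minPair? f) (∈-cartesianProduct⁺ (∈-allFin i) (∈-allFin j)) ij∈Min))))

  maxMin-attained : maxMin f ≡ 0 ⊎
                    ∃[ i ] ∃[ j ] (MinPair f (i , j) × ess (f ⟨ i ← j ⟩) ≡ maxMin f)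
  maxMin-attained with foldr-selective ⊔-sel 0 (map identifiedEss (filter (minPair? f) pairs))
  ... | inj₁ max≡0   = inj₁ max≡0
  ... | inj₂ max∈ess with ∈-map⁻ identifiedEss max∈ess
  ...   | (i , j) , ij∈min , max≡ =
    inj₂ (i , j , proj₂ (∈-filter⁻ (minPair? f) {xs = pairs} ij∈min) , sym max≡)

identify : {A : Set} {n : ℕ} → Fin n → Fin n → Vec A n → Vec A n
identify i j a = a [ i ]≔ lookup a j

module _ {A : Set} {n : ℕ} {i j : Fin n} where

  identify-onDiagonal : i ≢ j → (a : Vec A n) → lookup (identify i j a) i ≡ lookup (identify i j a) j
  identify-onDiagonal i≢j a = trans (lookup∘update i a _) (sym (lookup∘update′ (i≢j ∘ sym) a _))

  identify-onDiagonal-id : (a : Vec A n) → lookup a i ≡ lookup a j → identify i j a ≡ a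
  identify-onDiagonal-id a aᵢ≡aⱼ = trans (cong (a [ i ]≔_) (sym aᵢ≡aⱼ)) ([]≔-lookup a i)

  identify-update-source : i ≢ j → (a : Vec A n) (c : A) → identify i j (a [ i ]≔ c) ≡ identify i j a
  identify-update-source i≢j a c =
    trans (cong (a [ i ]≔ c [ i ]≔_) (lookup∘update′ (i≢j ∘ sym) a c)) ([]≔-idempotent a i)

  identify-update-target : (a : Vec A n) (c : A) → identify i j (a [ j ]≔ c) ≡ a [ j ]≔ c [ i ]≔ c
  identify-update-target a c = cong (a [ j ]≔ c [ i ]≔_) (lookup∘update j a c)

  identify-update-other : ∀ {r} → r ≢ i → r ≢ j → (a : Vec A n) (c : A) →
                          identify i j (a [ r ]≔ c) ≡ identify i j a [ r ]≔ c
  identify-update-other {r} r≢i r≢j a c =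
    trans (cong (a [ r ]≔ c [ i ]≔_) (lookup∘update′ (r≢j ∘ sym) a c)) ([]≔-commutes a r i r≢i)

module _ {n k : ℕ} where

  inessential⇒invariant : (g : Fun n k) {i : Fin n} → ¬ Essential g i →
                          ∀ a c → g a ≡ g (a [ i ]≔ c)
  inessential⇒invariant g {i} ¬ess a c =
    decidable-stable (g a ≟ g (a [ i ]≔ c)) (λ ne → ¬ess (a , c , ne))

  DiagonallyEssential : Fun n k → Fin n → Fin n → Fin n → Set
  DiagonallyEssential f i j r = ∃[ p ] ∃[ c ] (lookup p i ≡ lookup p j × f p ≢ f (p [ r ]≔ c))

  JointlyInessential : Fun n k → Fin n → Fin n → Set
  JointlyInessential f i j = ∀ p c → lookup p i ≡ lookup p j → f p ≡ f (p [ j ]≔ c [ i ]≔ c)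

  EssentialOutside : Fun n k → Fin n → Fin n → Set
  EssentialOutside g s t = ∀ x → x ≢ s → x ≢ t → Essential g x

  module _ (f : Fun n k) {i j : Fin n} where

    identified-source-inessential : i ≢ j → ¬ Essential (f ⟨ i ← j ⟩) i
    identified-source-inessential i≢j (a , c , ne) =
      ne (sym (cong f (identify-update-source i≢j a c)))

    essential⇒diagonallyEssential : ∀ {r} → i ≢ j → r ≢ i → r ≢ j →
                                    Essential (f ⟨ i ← j ⟩) r → DiagonallyEssential f i j r
    essential⇒diagonallyEssential i≢j r≢i r≢j (a , c , ne) =
      identify i j a , c , identify-onDiagonal i≢j a ,
      λ eq → ne (trans eq (sym (cong f (identify-update-other r≢i r≢j a c))))

    diagonallyEssential⇒essential : ∀ {r} → r ≢ i → r ≢ j →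
                                    DiagonallyEssential f i j r → Essential (f ⟨ i ← j ⟩) r
    diagonallyEssential⇒essential {r} r≢i r≢j (p , c , pᵢ≡pⱼ , ne) =
      p , c , λ eq → ne (begin
        f p                                 ≡⟨ cong f (identify-onDiagonal-id p pᵢ≡pⱼ) ⟨
        f (identify i j p)                  ≡⟨ eq ⟩
        f (identify i j (p [ r ]≔ c))       ≡⟨ cong f (identify-update-other r≢i r≢j p c) ⟩
        f (identify i j p [ r ]≔ c)         ≡⟨ cong (λ q → f (q [ r ]≔ c)) (identify-onDiagonal-id p pᵢ≡pⱼ) ⟩
        f (p [ r ]≔ c)                      ∎)
      where open ≡-Reasoning

    inessential⇒jointlyInessential : ¬ Essential (f ⟨ i ← j ⟩) j → JointlyInessential f i j
    inessential⇒jointlyInessential ¬ess p c pᵢ≡pⱼ = begin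
      f p                                      ≡⟨ cong f (identify-onDiagonal-id p pᵢ≡pⱼ) ⟨
      (f ⟨ i ← j ⟩) p                          ≡⟨ inessential⇒invariant (f ⟨ i ← j ⟩) ¬ess p c ⟩
      (f ⟨ i ← j ⟩) (p [ j ]≔ c)               ≡⟨ cong f (identify-update-target p c) ⟩
      f (p [ j ]≔ c [ i ]≔ c)                  ∎
      where open ≡-Reasoning

  diagonallyEssential-sym : {f : Fun n k} {i j r : Fin n} →
                            DiagonallyEssential f i j r → DiagonallyEssential f j i r
  diagonallyEssential-sym (p , c , pᵢ≡pⱼ , ne) = p , c , sym pᵢ≡pⱼ , ne

  module _ (f : Fun n k) where

    identified-target-essential-swap : ∀ {u v} → u ≢ v →
      Essential (f ⟨ u ← v ⟩) v → Essential (f ⟨ v ← u ⟩) u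
    identified-target-essential-swap {u} {v} u≢v (a , c , ne) = b , c , λ eq → ne (begin
      f b                                   ≡⟨ cong f (identify-onDiagonal-id b bᵥ≡bᵤ) ⟨
      (f ⟨ v ← u ⟩) b                       ≡⟨ eq ⟩
      (f ⟨ v ← u ⟩) (b [ u ]≔ c)            ≡⟨ cong f (identify-update-target b c) ⟩
      f (b [ u ]≔ c [ v ]≔ c)               ≡⟨ cong (λ q → f (q [ v ]≔ c)) ([]≔-idempotent a u) ⟩
      f (a [ u ]≔ c [ v ]≔ c)               ≡⟨ cong f ([]≔-commutes a u v u≢v) ⟩
      f (a [ v ]≔ c [ u ]≔ c)               ≡⟨ cong f (identify-update-target a c) ⟨
      (f ⟨ u ← v ⟩) (a [ v ]≔ c)            ∎)
      where
      open ≡-Reasoning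
      b : Vec (Fin k) n
      b = identify u v a
      bᵥ≡bᵤ : lookup b v ≡ lookup b u
      bᵥ≡bᵤ = sym (identify-onDiagonal u≢v a)

    diagonallyEssential-transfer : ∀ {i j m x} → JointlyInessential f i j →
      m ≢ i → m ≢ j → x ≢ i → x ≢ j → DiagonallyEssential f i j x → DiagonallyEssential f i m x
    diagonallyEssential-transfer {i} {j} {m} {x} joint m≢i m≢j x≢i x≢j (p , c , pᵢ≡pⱼ , ne) =
      q , c , qᵢ≡qₘ , λ eq → ne (begin
        f p                                 ≡⟨ joint p pₘ pᵢ≡pⱼ ⟩
        f q                                 ≡⟨ eq ⟩
        f (q [ x ]≔ c)                      ≡⟨ cong f (commute-past-pair p) ⟨
        f (p [ x ]≔ c [ j ]≔ pₘ [ i ]≔ pₘ)  ≡⟨ joint (p [ x ]≔ c) pₘ (update-onDiagonal pᵢ≡pⱼ) ⟨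
        f (p [ x ]≔ c)                      ∎)
      where
      open ≡-Reasoning
      pₘ : Fin k
      pₘ = lookup p m
      q : Vec (Fin k) n
      q = p [ j ]≔ pₘ [ i ]≔ pₘ
      qᵢ≡qₘ : lookup q i ≡ lookup q m
      qᵢ≡qₘ = trans (lookup∘update i (p [ j ]≔ pₘ) pₘ)
                (sym (trans (lookup∘update′ m≢i (p [ j ]≔ pₘ) pₘ) (lookup∘update′ m≢j p pₘ)))
      update-onDiagonal : lookup p i ≡ lookup p j → lookup (p [ x ]≔ c) i ≡ lookup (p [ x ]≔ c) j
      update-onDiagonal eq = trans (lookup∘update′ (x≢i ∘ sym) p c)
                               (trans eq (sym (lookup∘update′ (x≢j ∘ sym) p c)))
      commute-past-pair : ∀ (a : Vec (Fin k) n) → a [ x ]≔ c [ j ]≔ pₘ [ i ]≔ pₘ ≡ a [ j ]≔ pₘ [ i ]≔ pₘ [ x ]≔ c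
      commute-past-pair a = trans (cong (_[ i ]≔ pₘ) ([]≔-commutes a x j x≢j))
                                  ([]≔-commutes (a [ j ]≔ pₘ) x i x≢i)

    diagonallyEssential-exchange : ∀ {i j u} → JointlyInessential f i j → JointlyInessential f i u →
      i ≢ j → i ≢ u → j ≢ u → DiagonallyEssential f i j u → DiagonallyEssential f i u j
    diagonallyEssential-exchange {i} {j} {u} joint-ij joint-iu i≢j i≢u j≢u (p , c , pᵢ≡pⱼ , ne) =
      q , c , qᵢ≡qᵤ , λ eq → ne (begin
        f p                                  ≡⟨ joint-ij p pᵤ pᵢ≡pⱼ ⟩
        f q                                  ≡⟨ eq ⟩
        f (q [ j ]≔ c)                       ≡⟨ joint-iu (q [ j ]≔ c) c q′ᵢ≡q′ᵤ ⟩
        f (q [ j ]≔ c [ u ]≔ c [ i ]≔ c)     ≡⟨ cong f reorder ⟩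
        f (p [ u ]≔ c [ j ]≔ c [ i ]≔ c)     ≡⟨ joint-ij (p [ u ]≔ c) c p′ᵢ≡p′ⱼ ⟨
        f (p [ u ]≔ c)                       ∎)
      where
      open ≡-Reasoning
      pᵤ : Fin k
      pᵤ = lookup p u
      q : Vec (Fin k) n
      q = p [ j ]≔ pᵤ [ i ]≔ pᵤ
      qᵢ≡qᵤ : lookup q i ≡ lookup q u
      qᵢ≡qᵤ = trans (lookup∘update i (p [ j ]≔ pᵤ) pᵤ)
                (sym (trans (lookup∘update′ (i≢u ∘ sym) (p [ j ]≔ pᵤ) pᵤ)
                            (lookup∘update′ (j≢u ∘ sym) p pᵤ)))
      q′ᵢ≡q′ᵤ : lookup (q [ j ]≔ c) i ≡ lookup (q [ j ]≔ c) u
      q′ᵢ≡q′ᵤ = trans (lookup∘update′ i≢j q c) (trans qᵢ≡qᵤ (sym (lookup∘update′ (j≢u ∘ sym) q c)))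
      p′ᵢ≡p′ⱼ : lookup (p [ u ]≔ c) i ≡ lookup (p [ u ]≔ c) j
      p′ᵢ≡p′ⱼ = trans (lookup∘update′ i≢u p c) (trans pᵢ≡pⱼ (sym (lookup∘update′ j≢u p c)))
      reorder : q [ j ]≔ c [ u ]≔ c [ i ]≔ c ≡ p [ u ]≔ c [ j ]≔ c [ i ]≔ c
      reorder = begin
        p [ j ]≔ pᵤ [ i ]≔ pᵤ [ j ]≔ c [ u ]≔ c [ i ]≔ c
          ≡⟨ cong (λ a → a [ u ]≔ c [ i ]≔ c) ([]≔-commutes (p [ j ]≔ pᵤ) i j i≢j) ⟩
        p [ j ]≔ pᵤ [ j ]≔ c [ i ]≔ pᵤ [ u ]≔ c [ i ]≔ c
          ≡⟨ cong (λ a → a [ i ]≔ pᵤ [ u ]≔ c [ i ]≔ c) ([]≔-idempotent p j) ⟩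
        p [ j ]≔ c [ i ]≔ pᵤ [ u ]≔ c [ i ]≔ c
          ≡⟨ cong (_[ i ]≔ c) ([]≔-commutes (p [ j ]≔ c) i u i≢u) ⟩
        p [ j ]≔ c [ u ]≔ c [ i ]≔ pᵤ [ i ]≔ c
          ≡⟨ []≔-idempotent (p [ j ]≔ c [ u ]≔ c) i ⟩
        p [ j ]≔ c [ u ]≔ c [ i ]≔ c
          ≡⟨ cong (_[ i ]≔ c) ([]≔-commutes p j u j≢u) ⟩
        p [ u ]≔ c [ j ]≔ c [ i ]≔ c
          ∎

module _ {n k : ℕ} (f : Fun n k) where

  record PairLost (i j : Fin n) : Set where
    field
      distinct           : i ≢ j
      target-inessential : ¬ Essential (f ⟨ i ← j ⟩) j
      others-essential   : EssentialOutside (f ⟨ i ← j ⟩) i j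

    jointlyInessential : JointlyInessential f i j
    jointlyInessential = inessential⇒jointlyInessential f target-inessential

    diagonallyEssential : ∀ {r} → r ≢ i → r ≢ j → DiagonallyEssential f i j r
    diagonallyEssential r≢i r≢j =
      essential⇒diagonallyEssential f distinct r≢i r≢j (others-essential _ r≢i r≢j)

  record TargetKept : Set where
    field
      source target lost₁ lost₂ : Fin n
      distinct          : source ≢ target
      target-essential  : Essential (f ⟨ source ← target ⟩) target
      essential-outside : EssentialOutside (f ⟨ source ← target ⟩) lost₁ lost₂

  pairLost-sym : ∀ {i j} → PairLost i j → PairLost j i
  pairLost-sym sp = record
    { distinct           = distinct ∘ sym
    ; target-inessential = target-inessential ∘ identified-target-essential-swap f (distinct ∘ sym)
    ; others-essential   = λ x x≢j x≢i → diagonallyEssential⇒essential f x≢j x≢i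
                              (diagonallyEssential-sym (diagonallyEssential x≢i x≢j))
    }
    where open PairLost sp

  identified-from-source-essentialOutside : ∀ {i j m} → PairLost i j → m ≢ i → m ≢ j →
    Essential (f ⟨ i ← m ⟩) m → EssentialOutside (f ⟨ i ← m ⟩) i j
  identified-from-source-essentialOutside {m = m} sp m≢i m≢j essₘ x x≢i x≢j with x ≟ m
  ... | yes refl = essₘ
  ... | no x≢m   = diagonallyEssential⇒essential f x≢i x≢m
      (diagonallyEssential-transfer f jointlyInessential m≢i m≢j x≢i x≢j (diagonallyEssential x≢i x≢j))
    where open PairLost sp

  identified-disjoint-essentialOutside : ∀ {i j u v} → PairLost i j → ¬ Essential (f ⟨ i ← u ⟩) u →
    u ≢ i → u ≢ j → v ≢ i → v ≢ j → u ≢ v →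
    Essential (f ⟨ u ← v ⟩) v → EssentialOutside (f ⟨ u ← v ⟩) u i
  identified-disjoint-essentialOutside {i} {j} {u} {v} sp ¬essᵤ u≢i u≢j v≢i v≢j u≢v essᵥ = essential
    where
    open PairLost sp
    joint-ui : JointlyInessential f u i
    joint-ui = inessential⇒jointlyInessential f (¬essᵤ ∘ identified-target-essential-swap f u≢i)
    via-iu : ∀ {x} → x ≢ u → x ≢ i → x ≢ v → DiagonallyEssential f i u x → Essential (f ⟨ u ← v ⟩) x
    via-iu x≢u x≢i x≢v diag = diagonallyEssential⇒essential f x≢u x≢v
      (diagonallyEssential-transfer f joint-ui (u≢v ∘ sym) v≢i x≢u x≢i (diagonallyEssential-sym diag))
    essential : EssentialOutside (f ⟨ u ← v ⟩) u i
    essential x x≢u x≢i with x ≟ v | x ≟ j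
    ... | yes refl | _        = essᵥ
    ... | no x≢v   | yes refl = via-iu x≢u x≢i x≢v
      (diagonallyEssential-exchange f jointlyInessential (inessential⇒jointlyInessential f ¬essᵤ)
        distinct (u≢i ∘ sym) (u≢j ∘ sym) (diagonallyEssential u≢i u≢j))
    ... | no x≢v   | no x≢j   = via-iu x≢u x≢i x≢v
      (diagonallyEssential-transfer f jointlyInessential u≢i u≢j x≢i x≢j (diagonallyEssential x≢i x≢j))

  targetKept-at-source : ∀ {i j v} → PairLost i j → v ≢ i → Essential (f ⟨ i ← v ⟩) v → TargetKept
  targetKept-at-source {i} {j} {v} sp v≢i essᵥ with v ≟ j
  ... | yes refl = contradiction essᵥ (PairLost.target-inessential sp)
  ... | no v≢j   = record
    { source = i ; target = v ; lost₁ = i ; lost₂ = j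
    ; distinct          = v≢i ∘ sym
    ; target-essential  = essᵥ
    ; essential-outside = identified-from-source-essentialOutside sp v≢i v≢j essᵥ
    }

  targetKept : ∀ {i j u v} → PairLost i j → u ≢ v → Essential (f ⟨ u ← v ⟩) v → TargetKept
  targetKept {i} {j} {u} {v} sp u≢v essᵥ with u ≟ i | u ≟ j | v ≟ i | v ≟ j
  ... | yes refl | _        | _        | _        = targetKept-at-source sp (u≢v ∘ sym) essᵥ
  ... | no _     | yes refl | _        | _        = targetKept-at-source (pairLost-sym sp) (u≢v ∘ sym) essᵥ
  ... | no u≢i   | no _     | yes refl | _        =
    targetKept-at-source sp u≢i (identified-target-essential-swap f u≢v essᵥ)
  ... | no _     | no u≢j   | no _     | yes refl =
    targetKept-at-source (pairLost-sym sp) u≢j (identified-target-essential-swap f u≢v essᵥ)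
  ... | no u≢i   | no u≢j   | no v≢i   | no v≢j   with essential? (f ⟨ i ← u ⟩) u
  ...   | yes essᵤ = targetKept-at-source sp u≢i essᵤ
  ...   | no ¬essᵤ = record
    { source = u ; target = v ; lost₁ = u ; lost₂ = i
    ; distinct          = u≢v
    ; target-essential  = essᵥ
    ; essential-outside = identified-disjoint-essentialOutside sp ¬essᵤ u≢i u≢j v≢i v≢j u≢v essᵥ
    }

module _ {n k : ℕ} (f : Fun n k) where

  PlusWitness : ℕ → Set
  PlusWitness p = ∃[ i ] ∃[ j ] (i ≢ j × Essential (f ⟨ i ← j ⟩) j × ess (f ⟨ i ← j ⟩) ≡ n ∸ p)

  maxMin≡n∸2 : InG 2 n f → maxMin f ≡ n ∸ 2
  maxMin≡n∸2 (ess≡n , gap≡2) = m∸n≡1+o⇒n≡m∸1+o (subst (λ e → e ∸ maxMin f ≡ 2) ess≡n gap≡2)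

  identified-ess-≤ : InG 2 n f → ∀ {i j} → i ≢ j → ess (f ⟨ i ← j ⟩) ≤ n ∸ 2
  identified-ess-≤ g@(ess≡n , _) {i} {j} i≢j =
    subst (ess (f ⟨ i ← j ⟩) ≤_) (maxMin≡n∸2 g) (maxMin-upper f (i≢j , essential i , essential j))
    where
    essential : ∀ x → Essential f x
    essential = count-allFin≡n⇒universal (essential? f) ess≡n

  maximal-identification : 3 ≤ n → InG 2 n f → ∃[ i ] ∃[ j ] (i ≢ j × ess (f ⟨ i ← j ⟩) ≡ n ∸ 2)
  maximal-identification 3≤n g with maxMin-attained f
  ... | inj₁ max≡0 = contradiction (trans (sym max≡0) (maxMin≡n∸2 g)) (<⇒≢ (m<n⇒0<n∸m 3≤n))
  ... | inj₂ (i , j , (i≢j , _) , ess≡max) = i , j , i≢j , trans ess≡max (maxMin≡n∸2 g)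

  pairLost : 2 ≤ n → ∀ {i j} → i ≢ j → ess (f ⟨ i ← j ⟩) ≡ n ∸ 2 → ¬ Essential (f ⟨ i ← j ⟩) j →
             PairLost f i j
  pairLost 2≤n {i} {j} i≢j ess≡n∸2 ¬essⱼ = record
    { distinct = i≢j ; target-inessential = ¬essⱼ ; others-essential = others-essential }
    where
    others-essential : EssentialOutside (f ⟨ i ← j ⟩) i j
    others-essential x x≢i x≢j with essential? (f ⟨ i ← j ⟩) x
    ... | yes essₓ = essₓ
    ... | no ¬essₓ = contradiction
      (subst (λ e → 3 + e ≤ n) ess≡n∸2 (three-missing⇒3+count≤n (essential? (f ⟨ i ← j ⟩))
        i≢j (x≢i ∘ sym) (x≢j ∘ sym) (identified-source-inessential f i≢j) ¬essⱼ ¬essₓ))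
      (subst (λ m → ¬ suc m ≤ n) (sym (m+[n∸m]≡n 2≤n)) 1+n≰n)

  targetKept⇒plusWitness : InG 2 n f → TargetKept f → PlusWitness 2
  targetKept⇒plusWitness g pair =
    source , target , distinct , target-essential ,
    ≤-antisym (identified-ess-≤ g distinct)
              (m≤n+o⇒m∸n≤o n 2
                (all-but-two⇒n≤2+count (essential? (f ⟨ source ← target ⟩)) essential-outside))
    where open TargetKept pair

  gap-two-dichotomy : 3 ≤ n → InG 2 n f → InG+ 2 f ⊎ InG- 2 f
  gap-two-dichotomy 3≤n g with any? (λ u → any? (λ v → ¬? (u ≟ v) ×-dec essential? (f ⟨ u ← v ⟩) v))
  ... | no none = inj₂ (g , λ u v u≢v essᵥ → none (u , v , u≢v , essᵥ))
  ... | yes (u , v , u≢v , essᵥ) with maximal-identification 3≤n g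
  ...   | i , j , i≢j , ess≡n∸2 with essential? (f ⟨ i ← j ⟩) j
  ...     | yes essⱼ = inj₁ (g , i , j , i≢j , essⱼ , ess≡n∸2)
  ...     | no ¬essⱼ = inj₁ (g , targetKept⇒plusWitness g
                                   (targetKept f (pairLost (<⇒≤ 3≤n) i≢j ess≡n∸2 ¬essⱼ) u≢v essᵥ))

proposition4p2 : (k n : ℕ) → 3 ≤ k → 3 < n → n ≤ k → (f : Fun n k) →
    (InG 2 n f → InG+ 2 f ⊎ InG- 2 f) × (InG+ 2 f ⊎ InG- 2 f → InG 2 n f)
proposition4p2 k n _ 3<n _ f = gap-two-dichotomy f (<⇒≤ 3<n) , [ proj₁ , proj₁ ]′
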